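{- For all positive integers $m,n$, the complete bipartite graph $K_{m,n}$ is $Q$-unique: if $H$ is a finite simple graph with $Q(H;x,y)=Q(K_{m,n};x,y)$, then $H\cong K_{m,n}$.
   Context: For a finite simple graph $G=(V,E)$, the subgraph component polynomial is $Q(G;x,y)=\sum_{X\subseteq V} x^{|X|}y^{k(G[X])}$, where $G[X]$ is the induced subgraph on $X$ and $k(\cdot)$ denotes the number of connected components. -}

module Defs where

open import Data.Nat using (ℕ; zero; suc; _+_; _<ᵇ_)
open import Data.Bool using (Bool; true; false; _∧_; _∨_; not; _xor_; if_then_else_)
open import Data.Fin using (Fin; toℕ)
open import Data.Vec using (Vec; []; _∷_; lookup)
open import Data.List using (List; []; _∷_; map; _++_; length; filter)
open import Data.Vec.Functional using () renaming (foldr to vfoldr)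
open import Relation.Binary.PropositionalEquality using (_≡_)
open import Relation.Nullary using (does)
open import Data.Nat.Properties using (_≟_)
open import Function.Bundles using (_↔_; Inverse)

record Graph (n : ℕ) : Set where
  field
    adj    : Fin n → Fin n → Bool
    sym    : ∀ u v → adj u v ≡ adj v u
    irrefl : ∀ v → adj v v ≡ false
open Graph public

Subset : ℕ → Set
Subset n = Vec Bool n

_∈ˢ_ : ∀ {n} → Fin n → Subset n → Bool
v ∈ˢ X = lookup X v

allSubsets : (n : ℕ) → List (Subset n)
allSubsets zero = [] ∷ []
allSubsets (suc n) = map (false ∷_) (allSubsets n) ++ map (true ∷_) (allSubsets n)

size : ∀ {n} → Subset n → ℕ
size [] = 0
size (false ∷ X) = size X
size (true ∷ X) = suc (size X)

anyFin : ∀ {n} → (Fin n → Bool) → Bool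
anyFin {n} f = vfoldr _∨_ false f

reach : ∀ {n} → Graph n → Subset n → ℕ → Fin n → Fin n → Bool
reach G X zero u v = (u ∈ˢ X) ∧ does (toℕ u ≟ toℕ v)
reach G X (suc k) u v =
  reach G X k u v ∨ anyFin (λ w → reach G X k u w ∧ (v ∈ˢ X) ∧ adj G w v)

-- u and v lie in the same connected component of G[X]
-- (walks of length ≤ n suffice in an n-vertex graph)
connected : ∀ {n} → Graph n → Subset n → Fin n → Fin n → Bool
connected {n} G X u v = reach G X n u v

-- v is the least-indexed vertex of its component of G[X]
isLeader : ∀ {n} → Graph n → Subset n → Fin n → Bool
isLeader G X v = (v ∈ˢ X) ∧ not (anyFin (λ u → (toℕ u <ᵇ toℕ v) ∧ connected G X u v))

countFin : ∀ {n} → (Fin n → Bool) → ℕ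
countFin f = vfoldr (λ b r → if b then suc r else r) 0 f

components : ∀ {n} → Graph n → Subset n → ℕ
components G X = countFin (isLeader G X)

-- Q(G;x,y) = Σ_{X ⊆ V} x^|X| y^k(G[X]) is represented by its coefficient
-- array: coeffQ G i j = coefficient of x^i y^j = #{X : |X| = i, k(G[X]) = j}.
coeffQ : ∀ {n} → Graph n → ℕ → ℕ → ℕ
coeffQ {n} G i j =
  length (filter (λ X → (size X ≟ i) Relation.Nullary.×-dec (components G X ≟ j)) (allSubsets n))
  where import Relation.Nullary

SameQ : ∀ {p q} → Graph p → Graph q → Set
SameQ G H = ∀ i j → coeffQ G i j ≡ coeffQ H i j

record _≅_ {p q} (G : Graph p) (H : Graph q) : Set where
  field
    bij       : Fin p ↔ Fin q
    preserves : ∀ u v → adj G u v ≡ adj H (Inverse.to bij u) (Inverse.to bij v)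

-- complete bipartite graph K_{m,n} on Fin (m + n):
-- parts {i : i < m} and {i : m ≤ i}
K : (m n : ℕ) → Graph (m + n)
K m n = record
  { adj = λ u v → (toℕ u <ᵇ m) xor (toℕ v <ᵇ m)
  ; sym = λ u v → xor-comm (toℕ u <ᵇ m) (toℕ v <ᵇ m)
  ; irrefl = λ v → xor-self (toℕ v <ᵇ m)
  }
  where
  xor-comm : ∀ a b → a xor b ≡ b xor a
  xor-comm false false = Relation.Binary.PropositionalEquality.refl
  xor-comm false true = Relation.Binary.PropositionalEquality.refl
  xor-comm true false = Relation.Binary.PropositionalEquality.refl
  xor-comm true true = Relation.Binary.PropositionalEquality.refl
  xor-self : ∀ a → a xor a ≡ false
  xor-self false = Relation.Binary.PropositionalEquality.refl
  xor-self true = Relation.Binary.PropositionalEquality.refl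

module Submission where

-- A coefficient [x^i y^j] Q(G) counts the vertex sets X with |X| = i and k(G[X]) = j, and
-- k(G[X]) = |X| holds exactly when X is independent.  Let B be the larger part of K_{m,n}
-- and let H have the same polynomial.  Comparing single coefficients:
--   * [x^i] : H has as many vertices as K_{m,n};
--   * [x^s y^s] : H has an independent set A with |A| = |B| and none larger;
--   * [x^3 y^2] = 0 : H has no induced K₂ ∪ K₁;
--   * [x^2 y^2] = C(|B|,2) + C(|Bᶜ|,2) : the number of non-adjacent pairs of H.
-- A vertex outside A missing some vertex of A would miss all of A (no induced K₂ ∪ K₁),
-- contradicting the maximality of A; so every vertex outside A sees all of A.  Then every
-- non-adjacent pair lies inside A or inside Aᶜ, and the pair count forces Aᶜ to be
-- independent: H is complete bipartite with parts A, Aᶜ, and a permutation carrying A onto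
-- B is an isomorphism onto K_{m,n}.

open import Defs
open import Data.Nat using (ℕ; zero; suc; _+_; _≤_; _<_; _≤′_; ≤′-reflexive; ≤′-step; _<ᵇ_; _≡ᵇ_; z≤n; s≤s)
open import Data.Nat.Properties
open import Data.Bool as Bool using (Bool; true; false; _∧_; _∨_; not; _xor_; if_then_else_)
open import Data.Bool.Properties
  using (T-≡; ∧-zeroʳ; ∧-distribˡ-∨; xor-same; xor-annihilates-not; not-involutive)
import Data.Fin as F
open import Data.Fin using (Fin; toℕ)
open import Data.Fin.Properties using (toℕ-injective; toℕ<n; any?) renaming (_≟_ to _≟ᶠ_; suc-injective to fsuc-injective)
open import Data.Fin.Permutation
  using (Permutation′; _⟨$⟩ʳ_; _⟨$⟩ˡ_; inverseʳ; lift₀; transpose; _∘ₚ_; id; flip)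
open import Data.Vec using ([]; _∷_; lookup; replicate; tabulate; _[_]≔_) renaming (map to vmap)
open import Data.Vec.Properties
  using (lookup-map; lookup-replicate; lookup∘tabulate; lookup∘update; lookup∘update′; []≔-commutes)
open import Data.List using (List; []; _∷_; map; _++_; length; filter)
open import Data.List.Membership.Propositional using (_∈_)
open import Data.List.Membership.Propositional.Properties using (∈-map⁺; ∈-++⁺ˡ; ∈-++⁺ʳ)
open import Data.List.Relation.Unary.Any using (here; there)
open import Data.Product using (∃; _×_; _,_; proj₁; proj₂)
open import Data.Sum using (_⊎_; inj₁; inj₂; [_,_])
open import Data.Empty using (⊥; ⊥-elim)
open import Function using (_∘_; Equivalence)
open import Relation.Binary.Definitions using (tri<; tri≈; tri>)
open import Relation.Binary.PropositionalEquality
  using (_≡_; _≢_; refl; trans; cong; cong₂; subst; subst₂; module ≡-Reasoning) renaming (sym to ≡-sym)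
open import Relation.Nullary using (Dec; does; yes; no; _×-dec_)

true≢false : true ≢ false
true≢false ()

≢true⇒false : ∀ {b} → b ≢ true → b ≡ false
≢true⇒false {false} _ = refl
≢true⇒false {true} b≢true = ⊥-elim (b≢true refl)

≢false⇒true : ∀ {b} → b ≢ false → b ≡ true
≢false⇒true {true} _ = refl
≢false⇒true {false} b≢false = ⊥-elim (b≢false refl)

∧-elim : ∀ a {b} → (a ∧ b) ≡ true → a ≡ true × b ≡ true
∧-elim true e = refl , e

∧-intro : ∀ {a b} → a ≡ true → b ≡ true → (a ∧ b) ≡ true
∧-intro refl refl = refl

∨-elim : ∀ a {b} → (a ∨ b) ≡ true → a ≡ true ⊎ b ≡ true
∨-elim true _ = inj₁ refl
∨-elim false e = inj₂ e

∨-introˡ : ∀ {a} b → a ≡ true → (a ∨ b) ≡ true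
∨-introˡ _ refl = refl

∨-introʳ : ∀ a {b} → b ≡ true → (a ∨ b) ≡ true
∨-introʳ true _ = refl
∨-introʳ false e = e

∧-not-true : ∀ a {b} → b ≡ true → (a ∧ not b) ≡ false
∧-not-true a refl = ∧-zeroʳ a

∧-not-false : ∀ {a b} → a ≡ true → b ≡ false → (a ∧ not b) ≡ true
∧-not-false refl refl = refl

≡ᵇ-complete : ∀ {m n} → m ≡ n → (m ≡ᵇ n) ≡ true
≡ᵇ-complete {m} refl = Equivalence.to T-≡ (≡⇒≡ᵇ m m refl)

≡ᵇ-sound : ∀ {m n} → (m ≡ᵇ n) ≡ true → m ≡ n
≡ᵇ-sound {m} {n} e = ≡ᵇ⇒≡ m n (Equivalence.from T-≡ e)

≡ᵇ-false : ∀ {m n} → m ≢ n → (m ≡ᵇ n) ≡ false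
≡ᵇ-false m≢n = ≢true⇒false (m≢n ∘ ≡ᵇ-sound)

<ᵇ-complete : ∀ {m n} → m < n → (m <ᵇ n) ≡ true
<ᵇ-complete m<n = Equivalence.to T-≡ (<⇒<ᵇ m<n)

<ᵇ-sound : ∀ {m n} → (m <ᵇ n) ≡ true → m < n
<ᵇ-sound {m} {n} e = <ᵇ⇒< m n (Equivalence.from T-≡ e)

tick : Bool → ℕ → ℕ
tick b r = if b then suc r else r

tick-≥ : ∀ b r → r ≤ tick b r
tick-≥ true r = n≤1+n r
tick-≥ false r = ≤-refl

tick-mono : ∀ a b {r s} → (a ≡ true → b ≡ true) → r ≤ s → tick a r ≤ tick b s
tick-mono true true _ r≤s = s≤s r≤s
tick-mono true false a⇒b _ = ⊥-elim (true≢false (≡-sym (a⇒b refl)))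
tick-mono false true _ r≤s = m≤n⇒m≤1+n r≤s
tick-mono false false _ r≤s = r≤s

tick-< : ∀ a b {r s} → (a ≡ true → b ≡ true) → r < s → tick a r < tick b s
tick-< true b a⇒b r<s = tick-mono true b a⇒b r<s
tick-< false b a⇒b r<s = tick-mono false b a⇒b r<s

count-mono : ∀ {n} (f g : Fin n → Bool) → (∀ v → f v ≡ true → g v ≡ true) → countFin f ≤ countFin g
count-mono {zero} f g f⇒g = z≤n
count-mono {suc n} f g f⇒g =
  tick-mono (f F.zero) (g F.zero) (f⇒g F.zero) (count-mono (f ∘ F.suc) (g ∘ F.suc) (λ v → f⇒g (F.suc v)))

count-< : ∀ {n} (f g : Fin n → Bool) → (∀ v → f v ≡ true → g v ≡ true) →
  ∀ w → f w ≡ false → g w ≡ true → countFin f < countFin g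
count-< f g f⇒g F.zero fw gw rewrite fw | gw = s≤s (count-mono (f ∘ F.suc) (g ∘ F.suc) (λ v → f⇒g (F.suc v)))
count-< f g f⇒g (F.suc w) fw gw =
  tick-< (f F.zero) (g F.zero) (f⇒g F.zero) (count-< (f ∘ F.suc) (g ∘ F.suc) (λ v → f⇒g (F.suc v)) w fw gw)

count-ext : ∀ {n} (f g : Fin n → Bool) → (∀ v → f v ≡ g v) → countFin f ≡ countFin g
count-ext {zero} f g f≗g = refl
count-ext {suc n} f g f≗g rewrite f≗g F.zero = cong (tick (g F.zero)) (count-ext (f ∘ F.suc) (g ∘ F.suc) (f≗g ∘ F.suc))

count-none : ∀ {n} (f : Fin n → Bool) → (∀ v → f v ≡ false) → countFin f ≡ 0
count-none {zero} f none = refl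
count-none {suc n} f none rewrite none F.zero = count-none (f ∘ F.suc) (none ∘ F.suc)

count-≥1 : ∀ {n} (f : Fin n → Bool) w → f w ≡ true → 1 ≤ countFin f
count-≥1 f F.zero fw rewrite fw = s≤s z≤n
count-≥1 f (F.suc w) fw = ≤-trans (count-≥1 (f ∘ F.suc) w fw) (tick-≥ (f F.zero) _)

count-≥2 : ∀ {n} (f : Fin n → Bool) a b → f a ≡ true → f b ≡ true → a ≢ b → 2 ≤ countFin f
count-≥2 f F.zero F.zero _ _ a≢b = ⊥-elim (a≢b refl)
count-≥2 f F.zero (F.suc b) fa fb _ rewrite fa = s≤s (count-≥1 (f ∘ F.suc) b fb)
count-≥2 f (F.suc a) F.zero fa fb _ rewrite fb = s≤s (count-≥1 (f ∘ F.suc) a fa)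
count-≥2 f (F.suc a) (F.suc b) fa fb a≢b =
  ≤-trans (count-≥2 (f ∘ F.suc) a b fa fb (a≢b ∘ cong F.suc)) (tick-≥ (f F.zero) _)

count-≤1 : ∀ {n} (f : Fin n → Bool) → (∀ u v → f u ≡ true → f v ≡ true → u ≡ v) → countFin f ≤ 1
count-≤1 {zero} f unique = z≤n
count-≤1 {suc n} f unique with f F.zero in f0
... | true = s≤s (≤-reflexive (count-none (f ∘ F.suc) (λ v → ≢true⇒false (0≢1+n ∘ cong toℕ ∘ unique _ _ f0))))
... | false = count-≤1 (f ∘ F.suc) (λ u v fu fv → fsuc-injective (unique _ _ fu fv))

anyFin-elim : ∀ {n} (f : Fin n → Bool) → anyFin f ≡ true → ∃ λ w → f w ≡ true
anyFin-elim {suc n} f e with ∨-elim (f F.zero) e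
... | inj₁ f0 = F.zero , f0
... | inj₂ rest = let w , fw = anyFin-elim (f ∘ F.suc) rest in F.suc w , fw

anyFin-intro : ∀ {n} (f : Fin n → Bool) w → f w ≡ true → anyFin f ≡ true
anyFin-intro f F.zero fw = ∨-introˡ _ fw
anyFin-intro f (F.suc w) fw = ∨-introʳ (f F.zero) (anyFin-intro (f ∘ F.suc) w fw)

anyFin-none : ∀ {n} (f : Fin n → Bool) → (∀ w → f w ≡ false) → anyFin f ≡ false
anyFin-none f none = ≢true⇒false λ e → let w , fw = anyFin-elim f e in true≢false (trans (≡-sym fw) (none w))

_∈ₛ_ : ∀ {n} → Fin n → Subset n → Set
v ∈ₛ X = lookup X v ≡ true

_⊆_ : ∀ {n} → Subset n → Subset n → Set
X ⊆ A = ∀ v → v ∈ₛ X → v ∈ₛ A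

size-count : ∀ {n} (X : Subset n) → size X ≡ countFin (lookup X)
size-count [] = refl
size-count (true ∷ X) = cong suc (size-count X)
size-count (false ∷ X) = size-count X

⊆-size : ∀ {n} (X A : Subset n) → X ⊆ A → size X ≤ size A
⊆-size X A X⊆A = subst₂ _≤_ (≡-sym (size-count X)) (≡-sym (size-count A)) (count-mono _ _ X⊆A)

size≤n : ∀ {n} (X : Subset n) → size X ≤ n
size≤n [] = z≤n
size≤n (true ∷ X) = s≤s (size≤n X)
size≤n (false ∷ X) = m≤n⇒m≤1+n (size≤n X)

size-full : ∀ n → size (replicate n true) ≡ n
size-full zero = refl
size-full (suc n) = cong suc (size-full n)

member : ∀ {n} (X : Subset n) → 1 ≤ size X → ∃ λ v → v ∈ₛ X
member (true ∷ X) _ = F.zero , refl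
member (false ∷ X) 1≤size = let v , v∈X = member X 1≤size in F.suc v , v∈X

compl : ∀ {n} → Subset n → Subset n
compl = vmap not

∈-compl : ∀ {n} (A : Subset n) v → lookup (compl A) v ≡ not (lookup A v)
∈-compl A v = lookup-map v not A

∉⇒∈compl : ∀ {n} (A : Subset n) v → lookup A v ≡ false → v ∈ₛ compl A
∉⇒∈compl A v v∉A = trans (∈-compl A v) (cong not v∉A)

∈compl⇒∉ : ∀ {n} (A : Subset n) v → v ∈ₛ compl A → lookup A v ≡ false
∈compl⇒∉ A v v∈Aᶜ = ≢true⇒false λ v∈A → true≢false (trans (≡-sym v∈Aᶜ) (trans (∈-compl A v) (cong not v∈A)))

∈-or-∈compl : ∀ {n} (A : Subset n) v → v ∈ₛ A ⊎ v ∈ₛ compl A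
∈-or-∈compl A v with lookup A v in e
... | true = inj₁ refl
... | false = inj₂ (∉⇒∈compl A v e)

size-compl : ∀ {n} (X : Subset n) → size X + size (compl X) ≡ n
size-compl [] = refl
size-compl (true ∷ X) = cong suc (size-compl X)
size-compl (false ∷ X) = trans (+-suc (size X) _) (cong suc (size-compl X))

compl-involutive : ∀ {n} (X : Subset n) → compl (compl X) ≡ X
compl-involutive [] = refl
compl-involutive (x ∷ X) = cong₂ _∷_ (not-involutive x) (compl-involutive X)

∅ : ∀ {n} → Subset n
∅ = replicate _ false

insert : ∀ {n} → Fin n → Subset n → Subset n
insert w X = X [ w ]≔ true

size-∅ : ∀ n → size (∅ {n}) ≡ 0
size-∅ zero = refl
size-∅ (suc n) = size-∅ n

size-insert : ∀ {n} (X : Subset n) w → lookup X w ≡ false → size (insert w X) ≡ suc (size X)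
size-insert (false ∷ X) F.zero _ = refl
size-insert (true ∷ X) (F.suc w) w∉X = cong suc (size-insert X w w∉X)
size-insert (false ∷ X) (F.suc w) w∉X = size-insert X w w∉X

insert-∈ : ∀ {n} (X : Subset n) w → w ∈ₛ insert w X
insert-∈ X w = lookup∘update w X true

insert-⊇ : ∀ {n} (X : Subset n) w → X ⊆ insert w X
insert-⊇ X w v v∈X with v ≟ᶠ w
... | yes refl = insert-∈ X w
... | no v≢w = trans (lookup∘update′ v≢w X true) v∈X

∈-insert : ∀ {n} (X : Subset n) w v → v ∈ₛ insert w X → v ∈ₛ X ⊎ v ≡ w
∈-insert X w v v∈ with v ≟ᶠ w
... | yes v≡w = inj₂ v≡w
... | no v≢w = inj₁ (trans (≡-sym (lookup∘update′ v≢w X true)) v∈)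

size-remove : ∀ {n} (X : Subset n) w → w ∈ₛ X → size X ≡ suc (size (X [ w ]≔ false))
size-remove (true ∷ X) F.zero _ = refl
size-remove (true ∷ X) (F.suc w) w∈X = cong suc (size-remove X w w∈X)
size-remove (false ∷ X) (F.suc w) w∈X = size-remove X w w∈X

pair : ∀ {n} → Fin n → Fin n → Subset n
pair x o = insert o (insert x ∅)

triple : ∀ {n} → Fin n → Fin n → Fin n → Subset n
triple x o a = insert a (pair x o)

∈-pair : ∀ {n} (x o v : Fin n) → v ∈ₛ pair x o → v ≡ x ⊎ v ≡ o
∈-pair x o v v∈ with ∈-insert (insert x ∅) o v v∈
... | inj₂ v≡o = inj₂ v≡o
... | inj₁ v∈′ with ∈-insert ∅ x v v∈′
... | inj₂ v≡x = inj₁ v≡x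
... | inj₁ v∈∅ = ⊥-elim (true≢false (trans (≡-sym v∈∅) (lookup-replicate v false)))

∈-triple : ∀ {n} (x o a v : Fin n) → v ∈ₛ triple x o a → v ≡ x ⊎ v ≡ o ⊎ v ≡ a
∈-triple x o a v v∈ with ∈-insert (pair x o) a v v∈
... | inj₂ v≡a = inj₂ (inj₂ v≡a)
... | inj₁ v∈pair with ∈-pair x o v v∈pair
... | inj₁ v≡x = inj₁ v≡x
... | inj₂ v≡o = inj₂ (inj₁ v≡o)

∉-pair : ∀ {n} {x o v : Fin n} → v ≢ x → v ≢ o → lookup (pair x o) v ≡ false
∉-pair {x = x} {o} {v} v≢x v≢o = ≢true⇒false λ v∈ → [ v≢x , v≢o ] (∈-pair x o v v∈)


x∈pair : ∀ {n} (x o : Fin n) → x ∈ₛ pair x o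
x∈pair x o = insert-⊇ (insert x ∅) o x (insert-∈ ∅ x)

o∈pair : ∀ {n} (x o : Fin n) → o ∈ₛ pair x o
o∈pair x o = insert-∈ (insert x ∅) o

size-pair : ∀ {n} {x o : Fin n} → x ≢ o → size (pair x o) ≡ 2
size-pair {n} {x} {o} x≢o =
  trans (size-insert (insert x ∅) o o∉x) (cong suc (trans (size-insert ∅ x (lookup-replicate x false)) (cong suc (size-∅ n))))
  where
  o∉x : lookup (insert x ∅) o ≡ false
  o∉x = trans (lookup∘update′ (x≢o ∘ ≡-sym) ∅ true) (lookup-replicate o false)

size-triple : ∀ {n} {x o a : Fin n} → x ≢ o → a ≢ x → a ≢ o → size (triple x o a) ≡ 3
size-triple {x = x} {o} {a} x≢o a≢x a≢o = trans (size-insert (pair x o) a (∉-pair a≢x a≢o)) (cong suc (size-pair x≢o))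

triple-comm : ∀ {n} {x o : Fin n} a → x ≢ o → triple x o a ≡ triple o x a
triple-comm {x = x} {o} a x≢o = cong (insert a) ([]≔-commutes ∅ x o x≢o)

adj-distinct : ∀ {n} (G : Graph n) {u v} → adj G u v ≡ true → u ≢ v
adj-distinct G {u} uv refl = true≢false (trans (≡-sym uv) (irrefl G u))

module _ {n : ℕ} (G : Graph n) (X : Subset n) where

  Independent : Set
  Independent = ∀ u v → u ∈ₛ X → v ∈ₛ X → adj G u v ≡ false

  Isolated : Fin n → Set
  Isolated u = ∀ w → w ∈ₛ X → adj G u w ≡ false

  reach-zero-elim : ∀ u v → reach G X 0 u v ≡ true → u ∈ₛ X × u ≡ v
  reach-zero-elim u v e = let u∈X , u≡ᵇv = ∧-elim (lookup X u) e in u∈X , toℕ-injective (≡ᵇ-sound u≡ᵇv)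

  reach-suc-elim : ∀ k u v → reach G X (suc k) u v ≡ true →
    reach G X k u v ≡ true ⊎ ∃ λ w → reach G X k u w ≡ true × v ∈ₛ X × adj G w v ≡ true
  reach-suc-elim k u v e with ∨-elim (reach G X k u v) e
  ... | inj₁ shorter = inj₁ shorter
  ... | inj₂ extended =
    let w , p = anyFin-elim _ extended
        uw , q = ∧-elim (reach G X k u w) p
        v∈X , wv = ∧-elim (lookup X v) q
    in inj₂ (w , uw , v∈X , wv)

  reach-start : ∀ k u v → reach G X k u v ≡ true → u ∈ₛ X
  reach-start zero u v e = proj₁ (reach-zero-elim u v e)
  reach-start (suc k) u v e with reach-suc-elim k u v e
  ... | inj₁ shorter = reach-start k u v shorter
  ... | inj₂ (w , uw , _) = reach-start k u w uw

  reach-leaves : ∀ k u v → reach G X k u v ≡ true → u ≡ v ⊎ ∃ λ w → w ∈ₛ X × adj G u w ≡ true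
  reach-leaves zero u v e = inj₁ (proj₂ (reach-zero-elim u v e))
  reach-leaves (suc k) u v e with reach-suc-elim k u v e
  ... | inj₁ shorter = reach-leaves k u v shorter
  ... | inj₂ (w , uw , v∈X , wv) with reach-leaves k u w uw
  ... | inj₁ refl = inj₂ (v , v∈X , wv)
  ... | inj₂ first = inj₂ first

  reach-enters : ∀ k u v → reach G X k u v ≡ true → u ≡ v ⊎ ∃ λ w → w ∈ₛ X × adj G w v ≡ true
  reach-enters zero u v e = inj₁ (proj₂ (reach-zero-elim u v e))
  reach-enters (suc k) u v e with reach-suc-elim k u v e
  ... | inj₁ shorter = reach-enters k u v shorter
  ... | inj₂ (w , uw , _ , wv) = inj₂ (w , reach-end k u w uw , wv)
    where
    reach-end : ∀ k u v → reach G X k u v ≡ true → v ∈ₛ X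
    reach-end zero u v e = subst (_∈ₛ X) (proj₂ (reach-zero-elim u v e)) (proj₁ (reach-zero-elim u v e))
    reach-end (suc k) u v e with reach-suc-elim k u v e
    ... | inj₁ shorter = reach-end k u v shorter
    ... | inj₂ (_ , _ , v∈X , _) = v∈X

  reach-refl : ∀ u → u ∈ₛ X → reach G X 0 u u ≡ true
  reach-refl u u∈X = ∧-intro u∈X (≡ᵇ-complete {toℕ u} refl)

  reach-extend : ∀ k u w v → reach G X k u w ≡ true → v ∈ₛ X → adj G w v ≡ true → reach G X (suc k) u v ≡ true
  reach-extend k u w v uw v∈X wv =
    ∨-introʳ (reach G X k u v) (anyFin-intro (λ w′ → reach G X k u w′ ∧ (v ∈ˢ X) ∧ adj G w′ v) w (∧-intro uw (∧-intro v∈X wv)))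

  reach-weaken : ∀ {k k′} u v → k ≤′ k′ → reach G X k u v ≡ true → reach G X k′ u v ≡ true
  reach-weaken u v (≤′-reflexive refl) e = e
  reach-weaken u v (≤′-step k≤k′) e = ∨-introˡ _ (reach-weaken u v k≤k′ e)

  connected-edge : ∀ {u v} → u ∈ₛ X → v ∈ₛ X → adj G u v ≡ true → connected G X u v ≡ true
  connected-edge {u} {v} u∈X v∈X uv =
    reach-weaken u v (≤⇒≤′ (≤-trans (s≤s z≤n) (toℕ<n u))) (reach-extend 0 u u v (reach-refl u u∈X) v∈X uv)

  connected-via : ∀ {u w v} → u ∈ₛ X → w ∈ₛ X → v ∈ₛ X → adj G u w ≡ true → adj G w v ≡ true → connected G X u v ≡ true
  connected-via {u} {w} {v} u∈X w∈X v∈X uw wv =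
    reach-weaken u v (≤⇒≤′ (two≤n (adj-distinct G uw)))
      (reach-extend 1 u w v (reach-extend 0 u u w (reach-refl u u∈X) w∈X uw) v∈X wv)
    where
    two≤n : ∀ {m} {a b : Fin m} → a ≢ b → 2 ≤ m
    two≤n {suc zero} {F.zero} {F.zero} a≢b = ⊥-elim (a≢b refl)
    two≤n {suc (suc m)} _ = s≤s (s≤s z≤n)

  leader-∈ : ∀ v → isLeader G X v ≡ true → v ∈ₛ X
  leader-∈ v e = proj₁ (∧-elim (lookup X v) e)

  not-leader : ∀ u v → toℕ u < toℕ v → connected G X u v ≡ true → isLeader G X v ≡ false
  not-leader u v u<v uv =
    ∧-not-true (lookup X v) (anyFin-intro (λ u′ → (toℕ u′ <ᵇ toℕ v) ∧ connected G X u′ v) u (∧-intro (<ᵇ-complete u<v) uv))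

  leader-intro : ∀ v → v ∈ₛ X → (∀ u → toℕ u < toℕ v → connected G X u v ≢ true) → isLeader G X v ≡ true
  leader-intro v v∈X no-smaller = ∧-not-false v∈X (anyFin-none _ λ u → ≢true⇒false λ e →
    let u<ᵇv , uv = ∧-elim (toℕ u <ᵇ toℕ v) e in no-smaller u (<ᵇ-sound u<ᵇv) uv)

  isolated-leader : ∀ v → v ∈ₛ X → Isolated v → isLeader G X v ≡ true
  isolated-leader v v∈X isolated = leader-intro v v∈X no-walk
    where
    no-walk : ∀ u → toℕ u < toℕ v → connected G X u v ≢ true
    no-walk u u<v uv with reach-enters n u v uv
    ... | inj₁ refl = <-irrefl refl u<v
    ... | inj₂ (w , w∈X , wv) = true≢false (trans (≡-sym wv) (trans (Graph.sym G w v) (isolated w w∈X)))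

  leader-above-isolated : ∀ v → v ∈ₛ X → (∀ u → u ∈ₛ X → toℕ u < toℕ v → Isolated u) → isLeader G X v ≡ true
  leader-above-isolated v v∈X below-isolated = leader-intro v v∈X no-walk
    where
    no-walk : ∀ u → toℕ u < toℕ v → connected G X u v ≢ true
    no-walk u u<v uv with reach-leaves n u v uv
    ... | inj₁ refl = <-irrefl refl u<v
    ... | inj₂ (w , w∈X , uw) =
      true≢false (trans (≡-sym uw) (below-isolated u (reach-start n u v uv) u<v w w∈X))

  components≤size : components G X ≤ size X
  components≤size = subst (components G X ≤_) (≡-sym (size-count X)) (count-mono _ _ leader-∈)

  edge-to-later⇒components<size : ∀ u v → u ∈ₛ X → v ∈ₛ X → adj G u v ≡ true → toℕ u < toℕ v → components G X < size X
  edge-to-later⇒components<size u v u∈X v∈X uv u<v = subst (components G X <_) (≡-sym (size-count X))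
    (count-< _ _ leader-∈ v (not-leader u v u<v (connected-edge u∈X v∈X uv)) v∈X)

  edge⇒components<size : ∀ u v → u ∈ₛ X → v ∈ₛ X → adj G u v ≡ true → components G X < size X
  edge⇒components<size u v u∈X v∈X uv with <-cmp (toℕ u) (toℕ v)
  ... | tri< u<v _ _ = edge-to-later⇒components<size u v u∈X v∈X uv u<v
  ... | tri≈ _ u≡v _ = ⊥-elim (adj-distinct G uv (toℕ-injective u≡v))
  ... | tri> _ _ v<u = edge-to-later⇒components<size v u v∈X u∈X (trans (Graph.sym G v u) uv) v<u

  independent⇒components≡size : Independent → components G X ≡ size X
  independent⇒components≡size independent = trans (count-ext _ _ leader-iff-member) (≡-sym (size-count X))
    where
    leader-iff-member : ∀ v → isLeader G X v ≡ lookup X v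
    leader-iff-member v with ∈-or-∈compl X v
    ... | inj₁ v∈X = trans (isolated-leader v v∈X (λ w w∈X → independent v w v∈X w∈X)) (≡-sym v∈X)
    ... | inj₂ v∈Xᶜ = trans (≢true⇒false (λ leader → true≢false (trans (≡-sym (leader-∈ v leader)) v∉X))) (≡-sym v∉X)
      where
      v∉X : lookup X v ≡ false
      v∉X = ∈compl⇒∉ X v v∈Xᶜ

  components≡size⇒independent : components G X ≡ size X → Independent
  components≡size⇒independent k≡size u v u∈X v∈X = ≢true⇒false λ uv → <-irrefl k≡size (edge⇒components<size u v u∈X v∈X uv)

  connected⇒components≤1 : (∀ u v → u ∈ₛ X → v ∈ₛ X → connected G X u v ≡ true) → components G X ≤ 1
  connected⇒components≤1 linked = count-≤1 (isLeader G X) unique-leader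
    where
    unique-leader : ∀ a b → isLeader G X a ≡ true → isLeader G X b ≡ true → a ≡ b
    unique-leader a b la lb with <-cmp (toℕ a) (toℕ b)
    ... | tri< a<b _ _ = ⊥-elim (true≢false (trans (≡-sym lb) (not-leader a b a<b (linked a b (leader-∈ a la) (leader-∈ b lb)))))
    ... | tri≈ _ a≡b _ = toℕ-injective a≡b
    ... | tri> _ _ b<a = ⊥-elim (true≢false (trans (≡-sym la) (not-leader b a b<a (linked b a (leader-∈ b lb) (leader-∈ a la)))))

insert-independent : ∀ {n} (G : Graph n) (X : Subset n) v → Independent G X → Isolated G X v → Independent G (insert v X)
insert-independent G X v independent isolated x y x∈ y∈ with ∈-insert X v x x∈ | ∈-insert X v y y∈
... | inj₁ x∈X | inj₁ y∈X = independent x y x∈X y∈X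
... | inj₁ x∈X | inj₂ refl = trans (Graph.sym G x v) (isolated x x∈X)
... | inj₂ refl | inj₁ y∈X = isolated y y∈X
... | inj₂ refl | inj₂ refl = irrefl G v

K₂∪K₁-ordered : ∀ {n} (G : Graph n) {x o a} → adj G x o ≡ true → adj G a x ≡ false → adj G a o ≡ false →
  a ≢ x → a ≢ o → toℕ x < toℕ o → components G (triple x o a) ≡ 2
K₂∪K₁-ordered {n} G {x} {o} {a} xo ax ao a≢x a≢o x<o = ≤-antisym at-most-2 at-least-2
  where
  T : Subset n
  T = triple x o a
  x∈T : x ∈ₛ T
  x∈T = insert-⊇ (pair x o) a x (x∈pair x o)
  o∈T : o ∈ₛ T
  o∈T = insert-⊇ (pair x o) a o (o∈pair x o)
  a∈T : a ∈ₛ T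
  a∈T = insert-∈ (pair x o) a
  at-most-2 : components G T ≤ 2
  at-most-2 = ≤-pred (subst (components G T <_) (size-triple (adj-distinct G xo) a≢x a≢o) (edge⇒components<size G T x o x∈T o∈T xo))
  a-isolated : Isolated G T a
  a-isolated w w∈T with ∈-triple x o a w w∈T
  ... | inj₁ refl = ax
  ... | inj₂ (inj₁ refl) = ao
  ... | inj₂ (inj₂ refl) = irrefl G a
  below-x-isolated : ∀ u → u ∈ₛ T → toℕ u < toℕ x → Isolated G T u
  below-x-isolated u u∈T u<x with ∈-triple x o a u u∈T
  ... | inj₁ refl = ⊥-elim (<-irrefl refl u<x)
  ... | inj₂ (inj₁ refl) = ⊥-elim (<-asym u<x x<o)
  ... | inj₂ (inj₂ refl) = a-isolated
  at-least-2 : 2 ≤ components G T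
  at-least-2 = count-≥2 (isLeader G T) a x (isolated-leader G T a a∈T a-isolated)
    (leader-above-isolated G T x x∈T below-x-isolated) a≢x

K₂∪K₁-components : ∀ {n} (G : Graph n) {x o a} → adj G x o ≡ true → adj G a x ≡ false → adj G a o ≡ false →
  a ≢ x → a ≢ o → components G (triple x o a) ≡ 2
K₂∪K₁-components G {x} {o} {a} xo ax ao a≢x a≢o with <-cmp (toℕ x) (toℕ o)
... | tri< x<o _ _ = K₂∪K₁-ordered G xo ax ao a≢x a≢o x<o
... | tri≈ _ x≡o _ = ⊥-elim (adj-distinct G xo (toℕ-injective x≡o))
... | tri> _ _ o<x = subst (λ T → components G T ≡ 2) (triple-comm a (adj-distinct G (trans (Graph.sym G o x) xo)))
  (K₂∪K₁-ordered G (trans (Graph.sym G o x) xo) ao ax a≢o a≢x o<x)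

countL : ∀ {A : Set} → (A → Bool) → List A → ℕ
countL f [] = 0
countL f (x ∷ xs) = tick (f x) (countL f xs)

countL-filter : ∀ {A : Set} {P : A → Set} (P? : ∀ x → Dec (P x)) xs →
  length (filter P? xs) ≡ countL (λ x → does (P? x)) xs
countL-filter P? [] = refl
countL-filter P? (x ∷ xs) with does (P? x)
... | true = cong suc (countL-filter P? xs)
... | false = countL-filter P? xs

countL-++ : ∀ {A : Set} (f : A → Bool) xs ys → countL f (xs ++ ys) ≡ countL f xs + countL f ys
countL-++ f [] ys = refl
countL-++ f (x ∷ xs) ys with f x
... | true = cong suc (countL-++ f xs ys)
... | false = countL-++ f xs ys

countL-map : ∀ {A B : Set} (f : B → Bool) (g : A → B) xs → countL f (map g xs) ≡ countL (f ∘ g) xs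
countL-map f g [] = refl
countL-map f g (x ∷ xs) = cong (tick (f (g x))) (countL-map f g xs)

countL-mono : ∀ {A : Set} (f g : A → Bool) xs → (∀ x → f x ≡ true → g x ≡ true) → countL f xs ≤ countL g xs
countL-mono f g [] f⇒g = z≤n
countL-mono f g (x ∷ xs) f⇒g = tick-mono (f x) (g x) (f⇒g x) (countL-mono f g xs f⇒g)

countL-ext : ∀ {A : Set} (f g : A → Bool) xs → (∀ x → f x ≡ g x) → countL f xs ≡ countL g xs
countL-ext f g [] f≗g = refl
countL-ext f g (x ∷ xs) f≗g rewrite f≗g x = cong (tick (g x)) (countL-ext f g xs f≗g)

countL-none : ∀ {A : Set} (f : A → Bool) xs → (∀ x → f x ≡ false) → countL f xs ≡ 0
countL-none f [] none = refl
countL-none f (x ∷ xs) none rewrite none x = countL-none f xs none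

countL-≥1 : ∀ {A : Set} (f : A → Bool) {xs x} → x ∈ xs → f x ≡ true → 1 ≤ countL f xs
countL-≥1 f (here refl) fx rewrite fx = s≤s z≤n
countL-≥1 f {y ∷ _} (there x∈xs) fx = ≤-trans (countL-≥1 f x∈xs fx) (tick-≥ (f y) _)

countL-< : ∀ {A : Set} (f g : A → Bool) {xs x} → (∀ y → f y ≡ true → g y ≡ true) →
  x ∈ xs → f x ≡ false → g x ≡ true → countL f xs < countL g xs
countL-< f g {_ ∷ xs} f⇒g (here refl) fx gx rewrite fx | gx = s≤s (countL-mono f g xs f⇒g)
countL-< f g {y ∷ _} f⇒g (there x∈xs) fx gx = tick-< (f y) (g y) (f⇒g y) (countL-< f g f⇒g x∈xs fx gx)

countL-witness : ∀ {A : Set} (f : A → Bool) xs → 1 ≤ countL f xs → ∃ λ x → f x ≡ true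
countL-witness f (x ∷ xs) positive with f x in fx
... | true = x , fx
... | false = countL-witness f xs positive

countL-∨ : ∀ {A : Set} (f g : A → Bool) xs →
  countL (λ x → f x ∨ g x) xs + countL (λ x → f x ∧ g x) xs ≡ countL f xs + countL g xs
countL-∨ f g [] = refl
countL-∨ f g (x ∷ xs) with f x | g x
... | true | true = cong suc (trans (+-suc _ _) (trans (cong suc (countL-∨ f g xs)) (≡-sym (+-suc _ _))))
... | true | false = cong suc (countL-∨ f g xs)
... | false | true = trans (cong suc (countL-∨ f g xs)) (≡-sym (+-suc _ _))
... | false | false = countL-∨ f g xs

∈-allSubsets : ∀ {n} (X : Subset n) → X ∈ allSubsets n
∈-allSubsets [] = here refl
∈-allSubsets (false ∷ X) = ∈-++⁺ˡ (∈-map⁺ (false ∷_) (∈-allSubsets X))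
∈-allSubsets {suc n} (true ∷ X) = ∈-++⁺ʳ (map (false ∷_) (allSubsets n)) (∈-map⁺ (true ∷_) (∈-allSubsets X))

countL-allSubsets : ∀ {n} (f : Subset (suc n) → Bool) →
  countL f (allSubsets (suc n)) ≡ countL (f ∘ (false ∷_)) (allSubsets n) + countL (f ∘ (true ∷_)) (allSubsets n)
countL-allSubsets {n} f = trans (countL-++ f (map (false ∷_) (allSubsets n)) (map (true ∷_) (allSubsets n)))
  (cong₂ _+_ (countL-map f (false ∷_) (allSubsets n)) (countL-map f (true ∷_) (allSubsets n)))

choose : ℕ → ℕ → ℕ
choose n zero = 1
choose zero (suc k) = 0
choose (suc n) (suc k) = choose n k + choose n (suc k)

_⊆ᵇ_ : ∀ {n} → Subset n → Subset n → Bool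
[] ⊆ᵇ [] = true
(x ∷ X) ⊆ᵇ (a ∷ A) = (not x ∨ a) ∧ (X ⊆ᵇ A)

⊆ᵇ-complete : ∀ {n} (X A : Subset n) → X ⊆ A → (X ⊆ᵇ A) ≡ true
⊆ᵇ-complete [] [] _ = refl
⊆ᵇ-complete (true ∷ X) (a ∷ A) X⊆A rewrite X⊆A F.zero refl = ⊆ᵇ-complete X A (X⊆A ∘ F.suc)
⊆ᵇ-complete (false ∷ X) (a ∷ A) X⊆A = ⊆ᵇ-complete X A (X⊆A ∘ F.suc)

⊆ᵇ-sound : ∀ {n} (X A : Subset n) → (X ⊆ᵇ A) ≡ true → X ⊆ A
⊆ᵇ-sound (true ∷ X) (true ∷ A) e F.zero _ = refl
⊆ᵇ-sound (x ∷ X) (a ∷ A) e (F.suc v) v∈X = ⊆ᵇ-sound X A (proj₂ (∧-elim (not x ∨ a) e)) v v∈X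

count-k-subsets : ∀ {n} (A : Subset n) k → countL (λ X → (size X ≡ᵇ k) ∧ (X ⊆ᵇ A)) (allSubsets n) ≡ choose (size A) k
count-k-subsets [] zero = refl
count-k-subsets [] (suc k) = refl
count-k-subsets {suc n} (false ∷ A) k rewrite countL-allSubsets (λ X → (size X ≡ᵇ k) ∧ (X ⊆ᵇ (false ∷ A))) =
  trans (cong₂ _+_ (count-k-subsets A k) (countL-none _ (allSubsets n) (λ X → ∧-zeroʳ _))) (+-identityʳ _)
count-k-subsets {suc n} (true ∷ A) zero rewrite countL-allSubsets (λ X → (size X ≡ᵇ zero) ∧ (X ⊆ᵇ (true ∷ A))) =
  cong₂ _+_ (count-k-subsets A zero) (countL-none _ (allSubsets n) (λ X → refl))
count-k-subsets {suc n} (true ∷ A) (suc k) rewrite countL-allSubsets (λ X → (size X ≡ᵇ suc k) ∧ (X ⊆ᵇ (true ∷ A))) =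
  trans (cong₂ _+_ (count-k-subsets A (suc k)) (count-k-subsets A k)) (+-comm (choose (size A) (suc k)) _)

splitPair : ∀ {n} → Subset n → Subset n → Bool
splitPair A X = (size X ≡ᵇ 2) ∧ ((X ⊆ᵇ A) ∨ (X ⊆ᵇ compl A))

-- the two alternatives exclude each other, so their counts add up
count-splitPairs : ∀ {n} (A : Subset n) →
  countL (splitPair A) (allSubsets n) ≡ choose (size A) 2 + choose (size (compl A)) 2
count-splitPairs {n} A = begin
  countL (splitPair A) L                            ≡⟨ countL-ext _ _ L (λ X → ∧-distribˡ-∨ (size X ≡ᵇ 2) _ _) ⟩
  countL (λ X → inside X ∨ outside X) L             ≡⟨ ≡-sym (+-identityʳ _) ⟩
  countL (λ X → inside X ∨ outside X) L + 0         ≡⟨ cong (countL (λ X → inside X ∨ outside X) L +_) (≡-sym (countL-none _ L disjoint)) ⟩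
  countL (λ X → inside X ∨ outside X) L + countL (λ X → inside X ∧ outside X) L ≡⟨ countL-∨ inside outside L ⟩
  countL inside L + countL outside L                ≡⟨ cong₂ _+_ (count-k-subsets A 2) (count-k-subsets (compl A) 2) ⟩
  choose (size A) 2 + choose (size (compl A)) 2     ∎
  where
  open ≡-Reasoning
  L = allSubsets n
  inside outside : Subset n → Bool
  inside X = (size X ≡ᵇ 2) ∧ (X ⊆ᵇ A)
  outside X = (size X ≡ᵇ 2) ∧ (X ⊆ᵇ compl A)
  disjoint : ∀ X → (inside X ∧ outside X) ≡ false
  disjoint X = ≢true⇒false λ both →
    let in-A , in-Aᶜ = ∧-elim (inside X) both
        size-2 , X⊆A = ∧-elim (size X ≡ᵇ 2) in-A
        v , v∈X = member X (subst (1 ≤_) (≡-sym (≡ᵇ-sound size-2)) (s≤s z≤n))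
        v∈Aᶜ = ⊆ᵇ-sound X (compl A) (proj₂ (∧-elim (size X ≡ᵇ 2) in-Aᶜ)) v v∈X
    in true≢false (trans (≡-sym (⊆ᵇ-sound X A X⊆A v v∈X)) (∈compl⇒∉ A v v∈Aᶜ))

HasShape : ∀ {n} → Graph n → ℕ → ℕ → Subset n → Set
HasShape G i j X = size X ≡ i × components G X ≡ j

shape : ∀ {n} → Graph n → ℕ → ℕ → Subset n → Bool
shape G i j X = (size X ≡ᵇ i) ∧ (components G X ≡ᵇ j)

shape-complete : ∀ {n} (G : Graph n) {i j} X → HasShape G i j X → shape G i j X ≡ true
shape-complete G X (size≡i , k≡j) = ∧-intro (≡ᵇ-complete size≡i) (≡ᵇ-complete k≡j)

shape-sound : ∀ {n} (G : Graph n) {i j} X → shape G i j X ≡ true → HasShape G i j X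
shape-sound G {i} X e = let size≡ᵇi , k≡ᵇj = ∧-elim (size X ≡ᵇ i) e in ≡ᵇ-sound size≡ᵇi , ≡ᵇ-sound k≡ᵇj

coeffQ-countL : ∀ {n} (G : Graph n) i j → coeffQ G i j ≡ countL (shape G i j) (allSubsets n)
coeffQ-countL {n} G i j = countL-filter _ (allSubsets n)

SameQ-sym : ∀ {a b} {G : Graph a} {H : Graph b} → SameQ G H → SameQ H G
SameQ-sym same i j = ≡-sym (same i j)

transfer-shape : ∀ {a b} {G : Graph a} {H : Graph b} → SameQ G H →
  ∀ {i j} X → HasShape G i j X → ∃ λ Y → HasShape H i j Y
transfer-shape {a} {b} {G} {H} same {i} {j} X X-shape =
  let Y , Y-shape = countL-witness (shape H i j) (allSubsets b) (subst (1 ≤_) same-count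
                      (countL-≥1 (shape G i j) (∈-allSubsets X) (shape-complete G X X-shape)))
  in Y , shape-sound H Y Y-shape
  where
  same-count : countL (shape G i j) (allSubsets a) ≡ countL (shape H i j) (allSubsets b)
  same-count = trans (≡-sym (coeffQ-countL G i j)) (trans (same i j) (coeffQ-countL H i j))

-- the whole vertex set is realised, so Q determines the number of vertices
order-≤ : ∀ {a b} {G : Graph a} {H : Graph b} → SameQ G H → a ≤ b
order-≤ {a} {b} same =
  let Y , size-Y , _ = transfer-shape same (replicate a true) (size-full a , refl) in subst (_≤ b) size-Y (size≤n Y)

order-equal : ∀ {a b} (G : Graph a) (H : Graph b) → SameQ G H → a ≡ b
order-equal G H same = ≤-antisym (order-≤ {G = G} {H} same) (order-≤ {G = H} {G} (SameQ-sym {G = G} {H} same))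

data Placement {n} (X B : Subset n) : Set where
  inside  : X ⊆ B → Placement X B
  outside : X ⊆ compl B → Placement X B
  across  : ∀ l r → l ∈ₛ X → l ∈ₛ B → r ∈ₛ X → r ∈ₛ compl B → Placement X B

placement : ∀ {n} (X B : Subset n) → Placement X B
placement X B with any? (λ v → (lookup X v Bool.≟ true) ×-dec (lookup B v Bool.≟ true))
                 | any? (λ v → (lookup X v Bool.≟ true) ×-dec (lookup (compl B) v Bool.≟ true))
... | yes (l , l∈X , l∈B) | yes (r , r∈X , r∈Bᶜ) = across l r l∈X l∈B r∈X r∈Bᶜ
... | no none-in-B | _ = outside λ v v∈X → ∉⇒∈compl B v (≢true⇒false λ v∈B → none-in-B (v , v∈X , v∈B))
... | yes _ | no none-in-Bᶜ = inside λ v v∈X → side v v∈X (∈-or-∈compl B v)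
  where
  side : ∀ v → v ∈ₛ X → v ∈ₛ B ⊎ v ∈ₛ compl B → v ∈ₛ B
  side v _ (inj₁ v∈B) = v∈B
  side v v∈X (inj₂ v∈Bᶜ) = ⊥-elim (none-in-Bᶜ (v , v∈X , v∈Bᶜ))

Bipartition : ∀ {n} → Graph n → Subset n → Set
Bipartition G B = ∀ u v → adj G u v ≡ (lookup B u xor lookup B v)

swap-parts : ∀ {n} (G : Graph n) (B : Subset n) → Bipartition G B → Bipartition G (compl B)
swap-parts G B parts u v =
  trans (parts u v) (≡-sym (trans (cong₂ _xor_ (∈-compl B u) (∈-compl B v)) (xor-annihilates-not (lookup B u) (lookup B v))))

larger-part : ∀ {n} (G : Graph n) (B : Subset n) → Bipartition G B →
  ∃ λ B′ → Bipartition G B′ × size (compl B′) ≤ size B′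
larger-part G B parts with ≤-total (size (compl B)) (size B)
... | inj₁ Bᶜ≤B = B , parts , Bᶜ≤B
... | inj₂ B≤Bᶜ = compl B , swap-parts G B parts , subst (_≤ size (compl B)) (≡-sym (cong size (compl-involutive B))) B≤Bᶜ

module CompleteBipartite {n} (G : Graph n) (B : Subset n) (parts : Bipartition G B) where

  one-side-independent : ∀ X c → (∀ v → v ∈ₛ X → lookup B v ≡ c) → Independent G X
  one-side-independent X c side u v u∈X v∈X =
    trans (parts u v) (trans (cong₂ _xor_ (side u u∈X) (side v v∈X)) (xor-same c))

  inside-independent : ∀ X → X ⊆ B → Independent G X
  inside-independent X X⊆B = one-side-independent X true X⊆B

  outside-independent : ∀ X → X ⊆ compl B → Independent G X
  outside-independent X X⊆Bᶜ = one-side-independent X false (λ v v∈X → ∈compl⇒∉ B v (X⊆Bᶜ v v∈X))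

  crossing-edge : ∀ {u v} → u ∈ₛ B → v ∈ₛ compl B → adj G u v ≡ true
  crossing-edge {u} {v} u∈B v∈Bᶜ = trans (parts u v) (cong₂ _xor_ u∈B (∈compl⇒∉ B v v∈Bᶜ))

  crossing-edge′ : ∀ {u v} → u ∈ₛ compl B → v ∈ₛ B → adj G u v ≡ true
  crossing-edge′ {u} {v} u∈Bᶜ v∈B = trans (Graph.sym G u v) (crossing-edge v∈B u∈Bᶜ)

  -- a set meeting both parts is connected: any two of its vertices are joined by a walk of length ≤ 2
  across-connected : ∀ X l r → l ∈ₛ X → l ∈ₛ B → r ∈ₛ X → r ∈ₛ compl B → components G X ≤ 1
  across-connected X l r l∈X l∈B r∈X r∈Bᶜ = connected⇒components≤1 G X linked
    where
    linked : ∀ u v → u ∈ₛ X → v ∈ₛ X → connected G X u v ≡ true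
    linked u v u∈X v∈X with ∈-or-∈compl B u | ∈-or-∈compl B v
    ... | inj₁ u∈B | inj₁ v∈B = connected-via G X u∈X r∈X v∈X (crossing-edge u∈B r∈Bᶜ) (crossing-edge′ r∈Bᶜ v∈B)
    ... | inj₁ u∈B | inj₂ v∈Bᶜ = connected-edge G X u∈X v∈X (crossing-edge u∈B v∈Bᶜ)
    ... | inj₂ u∈Bᶜ | inj₁ v∈B = connected-edge G X u∈X v∈X (crossing-edge′ u∈Bᶜ v∈B)
    ... | inj₂ u∈Bᶜ | inj₂ v∈Bᶜ = connected-via G X u∈X l∈X v∈X (crossing-edge′ u∈Bᶜ l∈B) (crossing-edge l∈B v∈Bᶜ)

  -- [x^s y^s] Q(G) = 0 for s > |B|: independent sets lie in one part
  independent-bound : size (compl B) ≤ size B → ∀ X → Independent G X → size X ≤ size B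
  independent-bound Bᶜ≤B X independent with placement X B
  ... | inside X⊆B = ⊆-size X B X⊆B
  ... | outside X⊆Bᶜ = ≤-trans (⊆-size X (compl B) X⊆Bᶜ) Bᶜ≤B
  ... | across l r l∈X l∈B r∈X r∈Bᶜ = ⊥-elim (true≢false (trans (≡-sym (crossing-edge l∈B r∈Bᶜ)) (independent l r l∈X r∈X)))

  no-K₂∪K₁ : ∀ X → components G X ≡ 2 → size X ≡ 3 → ⊥
  no-K₂∪K₁ X k≡2 size≡3 = by-placement (placement X B)
    where
    within : Independent G X → ⊥
    within independent with trans (≡-sym k≡2) (trans (independent⇒components≡size G X independent) size≡3)
    ... | ()
    by-placement : Placement X B → ⊥
    by-placement (inside X⊆B) = within (inside-independent X X⊆B)
    by-placement (outside X⊆Bᶜ) = within (outside-independent X X⊆Bᶜ)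
    by-placement (across l r l∈X l∈B r∈X r∈Bᶜ) = 1+n≰n (subst (_≤ 1) k≡2 (across-connected X l r l∈X l∈B r∈X r∈Bᶜ))

  two-components : ∀ X → shape G 2 2 X ≡ splitPair B X
  two-components X with size X ≡ᵇ 2 in size≡ᵇ2
  ... | false = refl
  ... | true = by-placement (placement X B)
    where
    size≡2 : size X ≡ 2
    size≡2 = ≡ᵇ-sound size≡ᵇ2
    within : Independent G X → (components G X ≡ᵇ 2) ≡ true
    within independent = ≡ᵇ-complete (trans (independent⇒components≡size G X independent) size≡2)
    by-placement : Placement X B → (components G X ≡ᵇ 2) ≡ ((X ⊆ᵇ B) ∨ (X ⊆ᵇ compl B))
    by-placement (inside X⊆B) =
      trans (within (inside-independent X X⊆B)) (≡-sym (∨-introˡ _ (⊆ᵇ-complete X B X⊆B)))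
    by-placement (outside X⊆Bᶜ) =
      trans (within (outside-independent X X⊆Bᶜ)) (≡-sym (∨-introʳ (X ⊆ᵇ B) (⊆ᵇ-complete X (compl B) X⊆Bᶜ)))
    by-placement (across l r l∈X l∈B r∈X r∈Bᶜ) = trans not-two (≡-sym (cong₂ _∨_ not-in-B not-in-Bᶜ))
      where
      not-two : (components G X ≡ᵇ 2) ≡ false
      not-two = ≡ᵇ-false λ k≡2 → <-irrefl (trans k≡2 (≡-sym size≡2))
        (edge⇒components<size G X l r l∈X r∈X (crossing-edge l∈B r∈Bᶜ))
      not-in-B : (X ⊆ᵇ B) ≡ false
      not-in-B = ≢true⇒false λ X⊆B → true≢false (trans (≡-sym (⊆ᵇ-sound X B X⊆B r r∈X)) (∈compl⇒∉ B r r∈Bᶜ))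
      not-in-Bᶜ : (X ⊆ᵇ compl B) ≡ false
      not-in-Bᶜ = ≢true⇒false λ X⊆Bᶜ → true≢false (trans (≡-sym l∈B) (∈compl⇒∉ B l (⊆ᵇ-sound X (compl B) X⊆Bᶜ l l∈X)))

module Reconstruction {n} (H : Graph n) (A : Subset n)
  (A-independent : Independent H A)
  (A-maximum : ∀ X → Independent H X → size X ≤ size A)
  (no-K₂∪K₁ : ∀ X → components H X ≡ 2 → size X ≡ 3 → ⊥)
  (independent-pairs : countL (shape H 2 2) (allSubsets n) ≡ choose (size A) 2 + choose (size (compl A)) 2)
  where

  -- if v ∉ A misses some a ∈ A, then v misses every y ∈ A: otherwise {v, y, a} induces K₂ ∪ K₁
  misses-all : ∀ v a → lookup A v ≡ false → a ∈ₛ A → adj H v a ≡ false → Isolated H A v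
  misses-all v a v∉A a∈A va y y∈A = ≢true⇒false λ vy →
    no-K₂∪K₁ (triple v y a)
      (K₂∪K₁-components H vy (trans (Graph.sym H a v) va) (A-independent a y a∈A y∈A) a≢v (a≢y vy))
      (size-triple (adj-distinct H vy) a≢v (a≢y vy))
    where
    a≢v : a ≢ v
    a≢v refl = true≢false (trans (≡-sym a∈A) v∉A)
    a≢y : adj H v y ≡ true → a ≢ y
    a≢y vy refl = true≢false (trans (≡-sym vy) va)

  -- every vertex outside A sees all of A, since A ∪ {v} cannot be a larger independent set
  outside-sees-all : ∀ v a → lookup A v ≡ false → a ∈ₛ A → adj H v a ≡ true
  outside-sees-all v a v∉A a∈A = ≢false⇒true λ va → 1+n≰n (subst (_≤ size A) (size-insert A v v∉A)
    (A-maximum (insert v A) (insert-independent H A v A-independent (misses-all v a v∉A a∈A va))))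

  independent-pair-split : ∀ X → shape H 2 2 X ≡ true → splitPair A X ≡ true
  independent-pair-split X two-two with shape-sound H X two-two
  ... | size≡2 , k≡2 = ∧-intro (≡ᵇ-complete size≡2) (one-side (placement X A))
    where
    independent : Independent H X
    independent = components≡size⇒independent H X (trans k≡2 (≡-sym size≡2))
    one-side : Placement X A → ((X ⊆ᵇ A) ∨ (X ⊆ᵇ compl A)) ≡ true
    one-side (inside X⊆A) = ∨-introˡ _ (⊆ᵇ-complete X A X⊆A)
    one-side (outside X⊆Aᶜ) = ∨-introʳ (X ⊆ᵇ A) (⊆ᵇ-complete X (compl A) X⊆Aᶜ)
    one-side (across l r l∈X l∈A r∈X r∈Aᶜ) = ⊥-elim (true≢false
      (trans (≡-sym (outside-sees-all r l (∈compl⇒∉ A r r∈Aᶜ) l∈A)) (independent r l r∈X l∈X)))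

  -- an edge outside A would be a split pair that is not independent, making the count too small
  outside-independent : ∀ u v → lookup A u ≡ false → lookup A v ≡ false → adj H u v ≡ false
  outside-independent u v u∉A v∉A = ≢true⇒false λ uv →
    <-irrefl same-count (countL-< (shape H 2 2) (splitPair A) independent-pair-split (∈-allSubsets (pair u v))
      (not-independent uv) (split (adj-distinct H uv)))
    where
    same-count : countL (shape H 2 2) (allSubsets n) ≡ countL (splitPair A) (allSubsets n)
    same-count = trans independent-pairs (≡-sym (count-splitPairs A))
    not-independent : adj H u v ≡ true → shape H 2 2 (pair u v) ≡ false
    not-independent uv = ≢true⇒false λ two-two → let size≡2 , k≡2 = shape-sound H (pair u v) two-two in
      <-irrefl (trans k≡2 (≡-sym size≡2)) (edge⇒components<size H (pair u v) u v (x∈pair u v) (o∈pair u v) uv)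
    split : u ≢ v → splitPair A (pair u v) ≡ true
    split u≢v = ∧-intro (≡ᵇ-complete (size-pair u≢v)) (∨-introʳ (pair u v ⊆ᵇ A) (⊆ᵇ-complete (pair u v) (compl A) pair⊆Aᶜ))
      where
      pair⊆Aᶜ : pair u v ⊆ compl A
      pair⊆Aᶜ w w∈pair with ∈-pair u v w w∈pair
      ... | inj₁ refl = ∉⇒∈compl A u u∉A
      ... | inj₂ refl = ∉⇒∈compl A v v∉A

  bipartition : Bipartition H A
  bipartition u v with lookup A u in u∈A | lookup A v in v∈A
  ... | true | true = A-independent u v u∈A v∈A
  ... | true | false = trans (Graph.sym H u v) (outside-sees-all v u v∈A u∈A)
  ... | false | true = outside-sees-all u v u∈A v∈A
  ... | false | false = outside-independent u v u∈A v∈A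

Carries : ∀ {n} → Permutation′ n → Subset n → Subset n → Set
Carries σ A B = ∀ v → lookup A v ≡ lookup B (σ ⟨$⟩ʳ v)

Carried : ∀ {n} → Subset n → Subset n → Set
Carried A B = ∃ λ σ → Carries σ A B

carries-∘ : ∀ {n} (σ τ : Permutation′ n) {A B C} → Carries σ A B → Carries τ B C → Carries (σ ∘ₚ τ) A C
carries-∘ σ τ σ-carries τ-carries v = trans (σ-carries v) (τ-carries (σ ⟨$⟩ʳ v))

carries-flip : ∀ {n} (σ : Permutation′ n) {A B} → Carries σ A B → Carries (flip σ) B A
carries-flip σ {A} {B} σ-carries w = trans (cong (lookup B) (≡-sym (inverseʳ σ))) (≡-sym (σ-carries (σ ⟨$⟩ˡ w)))

carries-lift : ∀ {n} {σ : Permutation′ n} {A B} c → Carries σ A B → Carries (lift₀ σ) (c ∷ A) (c ∷ B)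
carries-lift c σ-carries F.zero = refl
carries-lift c σ-carries (F.suc v) = σ-carries v

carries-transpose : ∀ {n} (B : Subset n) j → j ∈ₛ B → Carries (transpose F.zero (F.suc j)) (true ∷ (B [ j ]≔ false)) (false ∷ B)
carries-transpose B j j∈B F.zero = ≡-sym j∈B
carries-transpose B j j∈B (F.suc v) with v ≟ᶠ j
... | yes refl = lookup∘update v B false
... | no v≢j = lookup∘update′ v≢j B false

carry-across : ∀ {n} (A B : Subset n) → suc (size A) ≡ size B →
  (∀ B′ → size A ≡ size B′ → Carried A B′) → Carried (true ∷ A) (false ∷ B)
carry-across A B size-eq carry with member B (subst (1 ≤_) size-eq (s≤s z≤n))
... | j , j∈B with carry (B [ j ]≔ false) (suc-injective (trans size-eq (size-remove B j j∈B)))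
... | σ , σ-carries = lift₀ σ ∘ₚ transpose F.zero (F.suc j) ,
  carries-∘ (lift₀ σ) (transpose F.zero (F.suc j)) {true ∷ A} {true ∷ (B [ j ]≔ false)} {false ∷ B} (carries-lift true σ-carries) (carries-transpose B j j∈B)

equal-size-carried : ∀ {n} (A B : Subset n) → size A ≡ size B → Carried A B
equal-size-carried [] [] _ = id , λ ()
equal-size-carried (true ∷ A) (true ∷ B) size-eq =
  let σ , σ-carries = equal-size-carried A B (suc-injective size-eq) in lift₀ σ , carries-lift true σ-carries
equal-size-carried (false ∷ A) (false ∷ B) size-eq =
  let σ , σ-carries = equal-size-carried A B size-eq in lift₀ σ , carries-lift false σ-carries
equal-size-carried (true ∷ A) (false ∷ B) size-eq = carry-across A B size-eq (equal-size-carried A)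
equal-size-carried (false ∷ A) (true ∷ B) size-eq =
  let σ , σ-carries = carry-across B A (≡-sym size-eq) (equal-size-carried B) in flip σ , carries-flip σ {true ∷ B} {false ∷ A} σ-carries

bipartite-iso : ∀ {n} (H G : Graph n) (A B : Subset n) → Bipartition H A → Bipartition G B → size A ≡ size B → H ≅ G
bipartite-iso H G A B H-parts G-parts size-eq with equal-size-carried A B size-eq
... | σ , σ-carries = record { bij = σ ; preserves = preserves }
  where
  preserves : ∀ u v → adj H u v ≡ adj G (σ ⟨$⟩ʳ u) (σ ⟨$⟩ʳ v)
  preserves u v = begin
    adj H u v                                 ≡⟨ H-parts u v ⟩
    lookup A u xor lookup A v                 ≡⟨ cong₂ _xor_ (σ-carries u) (σ-carries v) ⟩
    lookup B (σ ⟨$⟩ʳ u) xor lookup B (σ ⟨$⟩ʳ v) ≡⟨ ≡-sym (G-parts (σ ⟨$⟩ʳ u) (σ ⟨$⟩ʳ v)) ⟩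
    adj G (σ ⟨$⟩ʳ u) (σ ⟨$⟩ʳ v)               ∎
    where open ≡-Reasoning

Q-unique-bipartite : ∀ {n} (G H : Graph n) (B : Subset n) → Bipartition G B → size (compl B) ≤ size B →
  SameQ H G → H ≅ G
Q-unique-bipartite {n} G H B G-parts Bᶜ≤B same =
  bipartite-iso H G A B (Reconstruction.bipartition H A A-independent A-maximum H-no-K₂∪K₁ H-independent-pairs) G-parts size-A
  where
  open CompleteBipartite G B G-parts

  -- [x^|B| y^|B|] : B itself is independent, so H has an independent set A of that size
  A-realised : ∃ λ A → HasShape H (size B) (size B) A
  A-realised = transfer-shape {G = G} {H} (SameQ-sym {G = H} {G} same) B
    (refl , independent⇒components≡size G B (inside-independent B (λ _ v∈B → v∈B)))
  A : Subset n
  A = proj₁ A-realised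
  size-A : size A ≡ size B
  size-A = proj₁ (proj₂ A-realised)
  A-independent : Independent H A
  A-independent = components≡size⇒independent H A (trans (proj₂ (proj₂ A-realised)) (≡-sym size-A))

  -- [x^s y^s] : an independent set of H is matched by one of G, of size ≤ |B|
  A-maximum : ∀ X → Independent H X → size X ≤ size A
  A-maximum X independent =
    let Y , size-Y , k-Y = transfer-shape same X (refl , independent⇒components≡size H X independent)
    in subst₂ _≤_ size-Y (≡-sym size-A) (independent-bound Bᶜ≤B Y (components≡size⇒independent G Y (trans k-Y (≡-sym size-Y))))

  H-no-K₂∪K₁ : ∀ X → components H X ≡ 2 → size X ≡ 3 → ⊥
  H-no-K₂∪K₁ X k≡2 size≡3 = let Y , size-Y , k-Y = transfer-shape same X (size≡3 , k≡2) in no-K₂∪K₁ Y k-Y size-Y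

  size-Aᶜ : size (compl A) ≡ size (compl B)
  size-Aᶜ = +-cancelˡ-≡ (size A) _ _
    (trans (size-compl A) (≡-sym (trans (cong (_+ size (compl B)) size-A) (size-compl B))))

  H-independent-pairs : countL (shape H 2 2) (allSubsets n) ≡ choose (size A) 2 + choose (size (compl A)) 2
  H-independent-pairs = begin
    countL (shape H 2 2) (allSubsets n)            ≡⟨ ≡-sym (coeffQ-countL H 2 2) ⟩
    coeffQ H 2 2                                   ≡⟨ same 2 2 ⟩
    coeffQ G 2 2                                   ≡⟨ coeffQ-countL G 2 2 ⟩
    countL (shape G 2 2) (allSubsets n)            ≡⟨ countL-ext _ _ (allSubsets n) two-components ⟩
    countL (splitPair B) (allSubsets n)            ≡⟨ count-splitPairs B ⟩
    choose (size B) 2 + choose (size (compl B)) 2  ≡⟨ cong₂ (λ a b → choose a 2 + choose b 2) (≡-sym size-A) (≡-sym size-Aᶜ) ⟩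
    choose (size A) 2 + choose (size (compl A)) 2  ∎
    where open ≡-Reasoning

K-bipartition : ∀ m n → Bipartition (K m n) (tabulate (λ v → toℕ v <ᵇ m))
K-bipartition m n u v = ≡-sym (cong₂ _xor_ (lookup∘tabulate _ u) (lookup∘tabulate _ v))

-- Q determines the number of vertices, and K m n is Q-unique among graphs of its order.
-- (The argument does not need the positivity of m and n.)
theorem4p5 : (m n : ℕ) → 1 ≤ m → 1 ≤ n →
    ∀ {p} (H : Graph p) → SameQ H (K m n) → H ≅ K m n
theorem4p5 m n _ _ H same with order-equal H (K m n) same
... | refl with larger-part (K m n) (tabulate (λ v → toℕ v <ᵇ m)) (K-bipartition m n)
... | B , parts , Bᶜ≤B = Q-unique-bipartite (K m n) H B parts Bᶜ≤B same
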